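{- Let $c_1,c_2,c_3$ be numbers and let the sequence $[S_n,n\ge0]$ be defined by $S_0=1$, $S_1=c_1$, and $S_{n+1}=c_2S_n+c_3S_{n-1}$ for $n\ge1$. Let $[T_n,n\ge0]$ be its run length transform. Then $T_0=1$ and, for all $t>0$, $$T_{2t}=T_t,\qquad T_{4t+1}=c_1T_t,\qquad T_{4t+3}=c_2T_{2t+1}+c_3T_t.$$
   Context: For an integer $n\ge0$, $\mathcal{L}(n)$ is the list of lengths of the maximal runs of 1s in the binary expansion of $n$ (e.g. $\mathcal{L}(55)=[2,3]$ since $55=110111_2$; $\mathcal{L}(0)$ is empty). The run length transform of a sequence $[S_n,n\ge0]$ is the sequence $[T_n,n\ge0]$ given by $T_n=\prod_{i\in\mathcal{L}(n)}S_i$ (empty product equal to 1). -}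

module Defs where

open import Level using (Level)
open import Data.Bool using (Bool; true; false)
open import Data.Nat using (ℕ; zero; suc; _%_; _/_; _≡ᵇ_)
open import Data.List using (List; []; _∷_; reverse; map; foldr)
open import Algebra.Bundles using (CommutativeRing)

-- Binary digits of n, least significant first (no leading zeros; bits 0 = []).
-- The first argument is fuel; n is always enough fuel for n.
bitsAux : ℕ → ℕ → List Bool
bitsAux zero    _ = []
bitsAux (suc f) zero = []
bitsAux (suc f) n@(suc _) = (n % 2 ≡ᵇ 1) ∷ bitsAux f (n / 2)

bits : ℕ → List Bool
bits n = bitsAux n n

-- Lengths of maximal runs of `true` in a bit list.
-- The first argument is the length of the run currently being read.
flush : ℕ → List ℕ → List ℕ
flush zero    l = l
flush (suc k) l = suc k ∷ l

runsAux : ℕ → List Bool → List ℕ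
runsAux k []            = flush k []
runsAux k (true  ∷ bs)  = runsAux (suc k) bs
runsAux k (false ∷ bs)  = flush k (runsAux 0 bs)

runLengths : ℕ → List ℕ
runLengths n = runsAux 0 (reverse (bits n))

module _ {c ℓ : Level} (R : CommutativeRing c ℓ) where
  open CommutativeRing R

  runLengthTransform : (ℕ → Carrier) → ℕ → Carrier
  runLengthTransform S n = foldr _*_ 1# (map S (runLengths n))

  recSeq : Carrier → Carrier → Carrier → ℕ → Carrier
  recSeq c₁ c₂ c₃ zero = 1#
  recSeq c₁ c₂ c₃ (suc zero) = c₁
  recSeq c₁ c₂ c₃ (suc (suc n)) = c₂ * recSeq c₁ c₂ c₃ (suc n) + c₃ * recSeq c₁ c₂ c₃ n

-- Appending m ones to the binary expansion of n leaves every run of n untouched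
-- except the last one, whose length j (possibly 0) grows to m + j.  Hence
-- T(n followed by m ones) = X · S(m + j) for an X independent of m, and the
-- recurrence of S at index j becomes the identity for 4t+3 = (t followed by 11).
-- Appending a 0 and then m ones to t > 0 instead adds one new run of length m,
-- so T(2t) = T t · S 0 and T(4t+1) = T t · S 1.
module Submission where

open import Defs
open import Level using (Level)
open import Data.Bool using (true; false)
open import Data.Nat as N using (ℕ; zero; suc; _%_; _/_; _≤_; _>_; z≤n; s≤s)
open import Data.Nat.Properties using (≤-refl; ≤-trans; ≤-pred; m≤m*n; +-suc)
import Data.Nat.Properties as ℕₚ
open import Data.Nat.DivMod using (m/n<m; [m+kn]%n≡m%n; m*n%n≡0; m*n/n≡m; +-distrib-/)
open import Data.Nat.Tactic.RingSolver using (solve-∀)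
open import Data.List using (List; []; _∷_; _++_; [_]; reverse; map; foldr; replicate)
open import Data.List.Properties using (unfold-reverse; ++-assoc; ++-identityʳ)
open import Data.Product using (_×_; _,_; ∃₂)
open import Algebra.Bundles using (CommutativeRing)
open import Relation.Binary.PropositionalEquality as ≡ using (_≡_; cong)
import Relation.Binary.Reasoning.Setoid as SetoidReasoning

module _ where
  open N using (_+_; _*_)
  open ≡ using (refl)

  bitsAux-fuel : ∀ f g n → n ≤ f → n ≤ g → bitsAux f n ≡ bitsAux g n
  bitsAux-fuel zero    zero    zero    _       _       = refl
  bitsAux-fuel zero    (suc g) zero    _       _       = refl
  bitsAux-fuel (suc f) zero    zero    _       _       = refl
  bitsAux-fuel (suc f) (suc g) zero    _       _       = refl
  bitsAux-fuel (suc f) (suc g) (suc n) (s≤s n≤f) (s≤s n≤g) =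
    cong (_ ∷_) (bitsAux-fuel f g (suc n / 2) (≤-trans half≤n n≤f) (≤-trans half≤n n≤g))
    where
    half≤n : suc n / 2 ≤ n
    half≤n = ≤-pred (m/n<m (suc n) 2 (s≤s (s≤s z≤n)))

  [1+n*2]/2≡n : ∀ n → (1 + n * 2) / 2 ≡ n
  [1+n*2]/2≡n n = ≡.trans (+-distrib-/ 1 (n * 2) remainders<2) (m*n/n≡m n 2)
    where
    remainders<2 : 1 % 2 + (n * 2) % 2 N.< 2
    remainders<2 = ≡.subst (λ r → 1 + r N.< 2) (≡.sym (m*n%n≡0 n 2)) ≤-refl

  bits-odd : ∀ n → bits (1 + n * 2) ≡ true ∷ bits n
  bits-odd n rewrite [m+kn]%n≡m%n 1 n 2 ⦃ _ ⦄ | [1+n*2]/2≡n n =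
    cong (true ∷_) (bitsAux-fuel (n * 2) n n (m≤m*n n 2) ≤-refl)

  bits-even : ∀ n → n > 0 → bits (n * 2) ≡ false ∷ bits n
  bits-even (suc n) _ rewrite m*n%n≡0 (suc n) 2 ⦃ _ ⦄ | m*n/n≡m (suc n) 2 ⦃ _ ⦄ =
    cong (false ∷_) (bitsAux-fuel (suc (n * 2)) (suc n) (suc n) (s≤s (m≤m*n n 2)) ≤-refl)

  appendOnes : ℕ → ℕ → ℕ
  appendOnes zero    n = n
  appendOnes (suc m) n = 1 + appendOnes m n * 2

  reverse-bits-appendOnes : ∀ m n → reverse (bits (appendOnes m n)) ≡ reverse (bits n) ++ replicate m true
  reverse-bits-appendOnes zero    n = ≡.sym (++-identityʳ _)
  reverse-bits-appendOnes (suc m) n = begin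
    reverse (bits (1 + appendOnes m n * 2))       ≡⟨ cong reverse (bits-odd (appendOnes m n)) ⟩
    reverse (true ∷ bits (appendOnes m n))        ≡⟨ unfold-reverse true (bits (appendOnes m n)) ⟩
    reverse (bits (appendOnes m n)) ++ [ true ]   ≡⟨ cong (_++ [ true ]) (reverse-bits-appendOnes m n) ⟩
    (reverse (bits n) ++ replicate m true) ++ [ true ] ≡⟨ ++-assoc (reverse (bits n)) _ _ ⟩
    reverse (bits n) ++ replicate m true ++ [ true ]   ≡⟨ cong (reverse (bits n) ++_) (replicate-snoc m) ⟩
    reverse (bits n) ++ replicate (suc m) true ∎
    where
    open ≡.≡-Reasoning
    replicate-snoc : ∀ m → replicate m true ++ [ true ] ≡ true ∷ replicate m true
    replicate-snoc zero    = refl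
    replicate-snoc (suc m) = cong (true ∷_) (replicate-snoc m)

  flush-++ : ∀ k xs ys → flush k xs ++ ys ≡ flush k (xs ++ ys)
  flush-++ zero    xs ys = refl
  flush-++ (suc k) xs ys = refl

  runsAux-++-false : ∀ k xs ys → runsAux k (xs ++ false ∷ ys) ≡ runsAux k xs ++ runsAux 0 ys
  runsAux-++-false k []           ys = ≡.sym (flush-++ k [] _)
  runsAux-++-false k (true  ∷ xs) ys = runsAux-++-false (suc k) xs ys
  runsAux-++-false k (false ∷ xs) ys =
    ≡.trans (cong (flush k) (runsAux-++-false 0 xs ys)) (≡.sym (flush-++ k _ _))

  runsAux-replicate-true : ∀ k m → runsAux k (replicate m true) ≡ flush (m + k) []
  runsAux-replicate-true k zero    = refl
  runsAux-replicate-true k (suc m) =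
    ≡.trans (runsAux-replicate-true (suc k) m) (cong (λ l → flush l []) (+-suc m k))

  -- j is the length of the run of trailing ones of xs (plus k when xs has no zero).
  runsAux-++-replicate-true : ∀ k xs →
    ∃₂ λ P j → ∀ m → runsAux k (xs ++ replicate m true) ≡ P ++ flush (m + j) []
  runsAux-++-replicate-true k []           = [] , k , runsAux-replicate-true k
  runsAux-++-replicate-true k (true  ∷ xs) = runsAux-++-replicate-true (suc k) xs
  runsAux-++-replicate-true k (false ∷ xs) with runsAux-++-replicate-true 0 xs
  ... | P , j , eq = flush k P , j , λ m → ≡.trans (cong (flush k) (eq m)) (≡.sym (flush-++ k P _))

  runLengths-appendOnes : ∀ n → ∃₂ λ P j → ∀ m → runLengths (appendOnes m n) ≡ P ++ flush (m + j) []
  runLengths-appendOnes n with runsAux-++-replicate-true 0 (reverse (bits n))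
  ... | P , j , eq = P , j , λ m → ≡.trans (cong (runsAux 0) (reverse-bits-appendOnes m n)) (eq m)

  runLengths-appendOnes-double : ∀ m n → n > 0 →
    runLengths (appendOnes m (n * 2)) ≡ runLengths n ++ flush m []
  runLengths-appendOnes-double m n n>0 = begin
    runsAux 0 (reverse (bits (appendOnes m (n * 2))))        ≡⟨ cong (runsAux 0) (reverse-bits-appendOnes m (n * 2)) ⟩
    runsAux 0 (reverse (bits (n * 2)) ++ replicate m true)   ≡⟨ cong (λ bs → runsAux 0 (reverse bs ++ _)) (bits-even n n>0) ⟩
    runsAux 0 (reverse (false ∷ bits n) ++ replicate m true) ≡⟨ cong (λ bs → runsAux 0 (bs ++ _)) (unfold-reverse false (bits n)) ⟩
    runsAux 0 ((reverse (bits n) ++ [ false ]) ++ replicate m true) ≡⟨ cong (runsAux 0) (++-assoc (reverse (bits n)) _ _) ⟩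
    runsAux 0 (reverse (bits n) ++ false ∷ replicate m true) ≡⟨ runsAux-++-false 0 (reverse (bits n)) _ ⟩
    runLengths n ++ runsAux 0 (replicate m true)             ≡⟨ cong (runLengths n ++_) (runsAux-replicate-true 0 m) ⟩
    runLengths n ++ flush (m + 0) []                         ≡⟨ cong (λ l → runLengths n ++ flush l []) (ℕₚ.+-identityʳ m) ⟩
    runLengths n ++ flush m [] ∎
    where open ≡.≡-Reasoning

  4t+1≡1+t*2*2 : ∀ t → 4 * t + 1 ≡ 1 + t * 2 * 2
  4t+1≡1+t*2*2 = solve-∀

  2t+1≡1+t*2 : ∀ t → 2 * t + 1 ≡ 1 + t * 2
  2t+1≡1+t*2 = solve-∀

  4t+3≡1+[1+t*2]*2 : ∀ t → 4 * t + 3 ≡ 1 + (1 + t * 2) * 2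
  4t+3≡1+[1+t*2]*2 = solve-∀

module RunLengthTransform {c ℓ : Level} (R : CommutativeRing c ℓ)
  (S : ℕ → CommutativeRing.Carrier R) (S0≈1 : CommutativeRing._≈_ R (S 0) (CommutativeRing.1# R)) where

  open CommutativeRing R
  open SetoidReasoning setoid
  open import Algebra.Properties.CommutativeSemigroup *-commutativeSemigroup using (x∙yz≈y∙xz)

  T : ℕ → Carrier
  T = runLengthTransform R S

  productMap : List ℕ → Carrier
  productMap l = foldr _*_ 1# (map S l)

  productMap-++ : ∀ xs ys → productMap (xs ++ ys) ≈ productMap xs * productMap ys
  productMap-++ []       ys = sym (*-identityˡ _)
  productMap-++ (x ∷ xs) ys = begin
    S x * productMap (xs ++ ys)           ≈⟨ *-congˡ (productMap-++ xs ys) ⟩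
    S x * (productMap xs * productMap ys) ≈⟨ sym (*-assoc _ _ _) ⟩
    S x * productMap xs * productMap ys   ∎

  productMap-flush : ∀ n → productMap (flush n []) ≈ S n
  productMap-flush zero    = sym S0≈1
  productMap-flush (suc n) = *-identityʳ _

  productMap-++-flush : ∀ xs n → productMap (xs ++ flush n []) ≈ productMap xs * S n
  productMap-++-flush xs n = trans (productMap-++ xs _) (*-congˡ (productMap-flush n))

  T-appendOnes-double : ∀ m n → n > 0 → T (appendOnes m (n N.* 2)) ≈ T n * S m
  T-appendOnes-double m n n>0 =
    trans (reflexive (cong productMap (runLengths-appendOnes-double m n n>0)))
          (productMap-++-flush (runLengths n) m)

  T-appendOnes : ∀ n → ∃₂ λ (X : Carrier) j → ∀ m → T (appendOnes m n) ≈ X * S (m N.+ j)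
  T-appendOnes n with runLengths-appendOnes n
  ... | P , j , eq = productMap P , j , λ m → trans (reflexive (cong productMap (eq m))) (productMap-++-flush P (m N.+ j))

  T-recurrence : ∀ a b → (∀ j → S (suc (suc j)) ≈ a * S (suc j) + b * S j) →
    ∀ n m → T (appendOnes (suc (suc m)) n) ≈ a * T (appendOnes (suc m) n) + b * T (appendOnes m n)
  T-recurrence a b S-rec n m with T-appendOnes n
  ... | X , j , T≈ = begin
    T (appendOnes (suc (suc m)) n)                    ≈⟨ T≈ (suc (suc m)) ⟩
    X * S (suc (suc (m N.+ j)))                       ≈⟨ *-congˡ (S-rec (m N.+ j)) ⟩
    X * (a * S (suc (m N.+ j)) + b * S (m N.+ j))     ≈⟨ distribˡ X _ _ ⟩
    X * (a * S (suc (m N.+ j))) + X * (b * S (m N.+ j)) ≈⟨ +-cong (x∙yz≈y∙xz X a _) (x∙yz≈y∙xz X b _) ⟩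
    a * (X * S (suc (m N.+ j))) + b * (X * S (m N.+ j)) ≈⟨ sym (+-cong (*-congˡ (T≈ (suc m))) (*-congˡ (T≈ m))) ⟩
    a * T (appendOnes (suc m) n) + b * T (appendOnes m n) ∎

theorem3 : {c ℓ : Level} (R : CommutativeRing c ℓ) →
  let open CommutativeRing R in
  (c₁ c₂ c₃ : Carrier) →
  let T = runLengthTransform R (recSeq R c₁ c₂ c₃) in
  (T 0 ≈ 1#) ×
  ((t : ℕ) → t > 0 →
    (T (2 N.* t) ≈ T t) ×
    (T (4 N.* t N.+ 1) ≈ c₁ * T t) ×
    (T (4 N.* t N.+ 3) ≈ (c₂ * T (2 N.* t N.+ 1)) + (c₃ * T t)))
theorem3 R c₁ c₂ c₃ = refl , λ t t>0 → T-2t t t>0 , T-4t+1 t t>0 , T-4t+3 t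
  where
  open CommutativeRing R
  open RunLengthTransform R (recSeq R c₁ c₂ c₃) refl

  T-at : ∀ {a b} → a ≡ b → T a ≈ T b
  T-at eq = reflexive (cong T eq)

  T-2t : ∀ t → t > 0 → T (2 N.* t) ≈ T t
  T-2t t t>0 = trans (T-at (ℕₚ.*-comm 2 t)) (trans (T-appendOnes-double 0 t t>0) (*-identityʳ (T t)))

  T-4t+1 : ∀ t → t > 0 → T (4 N.* t N.+ 1) ≈ c₁ * T t
  T-4t+1 t t>0 = trans (T-at (4t+1≡1+t*2*2 t)) (trans (T-appendOnes-double 1 t t>0) (*-comm (T t) c₁))

  T-4t+3 : ∀ t → T (4 N.* t N.+ 3) ≈ c₂ * T (2 N.* t N.+ 1) + c₃ * T t
  T-4t+3 t = begin
    T (4 N.* t N.+ 3)                       ≈⟨ T-at (4t+3≡1+[1+t*2]*2 t) ⟩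
    T (appendOnes 2 t)                      ≈⟨ T-recurrence c₂ c₃ (λ _ → refl) t 0 ⟩
    c₂ * T (appendOnes 1 t) + c₃ * T t      ≈⟨ +-congʳ (*-congˡ (T-at (≡.sym (2t+1≡1+t*2 t)))) ⟩
    c₂ * T (2 N.* t N.+ 1) + c₃ * T t       ∎
    where open SetoidReasoning setoid
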